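{- Let $G=(V,E,w)$ be a finite graph with positive rational edge weights $w:E\to\mathbb{Q}_{>0}$. Define $h:2^V\to\mathbb{R}$ by $h(A)=\sum_{v\in V}h_A(v)$, where $h_A(v)=W(v)/2$ if $v\in A$ or $W_A(v)\ge W(v)/2$, and $h_A(v)=W_A(v)$ otherwise. Run the greedy algorithm on $U=V$ with potential $h$: start with $S=\emptyset$; while some $u\in V\setminus S$ has $h(S\cup\{u\})-h(S)>0$, add to $S$ a vertex $x\in V\setminus S$ maximizing $h(S\cup\{x\})-h(S)$ (ties broken arbitrarily); then return $S$. Then $S$ is a weighted partial positive influence dominating set of $G$ and $|S|\le\big(1+\ln(\tfrac32\cdot L\cdot W)\big)\cdot|S^*|$, where $S^*$ is a weighted partial positive influence dominating set of minimum cardinality.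
   Context: For $v\in V$ and $A\subseteq V$, $W_A(v)=\sum_{u\in N(v)\cap A} w(v,u)$, $W(v)=W_V(v)$ and $W=\max_{v\in V}W(v)$. A set $S\subseteq V$ is a weighted partial positive influence dominating set (WPPIDS) if every $v\in V\setminus S$ satisfies $W_S(v)\ge W(v)/2$. For each vertex $v$ with incident edge weights $w_1,\dots,w_d$, write $W(v)/2=p_0/q_0$ and $w_i=p_i/q_i$ as reduced fractions with positive integer denominators, let $l(v)=\mathrm{lcm}\{q_0,q_1,\dots,q_d\}$, and let $L=\max_{v\in V} l(v)$. -}

module Defs where

import Data.Bool
open import Data.Bool using (Bool; true; false; _∧_; if_then_else_)
open import Data.Nat as ℕ using (ℕ; zero; suc)
open import Data.Nat.LCM using (lcm)
open import Data.Integer as ℤ using (ℤ; +_)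
open import Data.Rational as ℚ using (ℚ; 0ℚ; 1ℚ; ½; _/_; _+_; _-_; _*_; _≤_; _<_; _⊔_)
open import Data.Rational.Properties using (_≤?_)
open import Data.Fin using (Fin)
open import Data.Fin.Subset using (Subset; _∈_; _∉_; _∪_; ⁅_⁆; ⊥; ∣_∣)
open import Data.Fin.Subset.Properties using (_∈?_)
open import Data.List using (List; foldr; map)
open import Data.List.Base using (filter)
open import Data.Vec.Functional using ()
open import Data.Fin.Base using ()
open import Data.List using (allFin)
open import Data.Product using (_×_; Σ; _,_)
open import Relation.Nullary using (Dec; yes; no; ¬_)
open import Relation.Nullary.Decidable using (isYes)
open import Relation.Binary.PropositionalEquality using (_≡_)
open import Relation.Binary.Construct.Closure.ReflexiveTransitive using (Star)

-- A finite simple undirected graph on vertex set Fin n with positive rational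
-- edge weights (weights of non-edges are irrelevant: only neighbours are used).
record WGraph (n : ℕ) : Set where
  field
    adj     : Fin n → Fin n → Bool
    adj-sym : ∀ u v → adj u v ≡ adj v u
    adj-irr : ∀ v → adj v v ≡ false
    w       : Fin n → Fin n → ℚ
    w-sym   : ∀ u v → adj u v ≡ true → w u v ≡ w v u
    w-pos   : ∀ u v → adj u v ≡ true → 0ℚ < w u v

module _ {n : ℕ} (G : WGraph n) where
  open WGraph G

  sumℚ : List ℚ → ℚ
  sumℚ = foldr _+_ 0ℚ

  nbrs : Fin n → List (Fin n)
  nbrs v = filter (λ u → adj v u Data.Bool.≟ true) (allFin n)

  W[_]_ : Subset n → Fin n → ℚ
  W[ A ] v = sumℚ (map (λ u → if isYes (u ∈? A) then w v u else 0ℚ) (nbrs v))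

  Wv : Fin n → ℚ
  Wv v = sumℚ (map (w v) (nbrs v))

  -- W = max_v W(v)  (all W(v) ≥ 0, so 0 is a neutral start)
  Wmax : ℚ
  Wmax = foldr _⊔_ 0ℚ (map Wv (allFin n))

  IsWPPIDS : Subset n → Set
  IsWPPIDS S = ∀ v → v ∉ S → ½ * Wv v ≤ W[ S ] v

  hv : Subset n → Fin n → ℚ
  hv A v with v ∈? A | ½ * Wv v ≤? W[ A ] v
  ... | yes _ | _     = ½ * Wv v
  ... | no _  | yes _ = ½ * Wv v
  ... | no _  | no _  = W[ A ] v

  h : Subset n → ℚ
  h A = sumℚ (map (hv A) (allFin n))

  gain : Subset n → Fin n → ℚ
  gain S u = h (S ∪ ⁅ u ⁆) - h S

  GreedyStep : Subset n → Subset n → Set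
  GreedyStep S S' = Σ (Fin n) λ x →
    x ∉ S × 0ℚ < gain S x × (∀ u → u ∉ S → gain S u ≤ gain S x) × S' ≡ S ∪ ⁅ x ⁆

  GreedyStops : Subset n → Set
  GreedyStops S = ∀ u → u ∉ S → gain S u ≤ 0ℚ

  GreedyOutput : Subset n → Set
  GreedyOutput S = Star GreedyStep ⊥ S × GreedyStops S

  lv : Fin n → ℕ
  lv v = foldr lcm (ℚ.denominatorℕ (½ * Wv v)) (map (λ u → ℚ.denominatorℕ (w v u)) (nbrs v))

  Lmax : ℕ
  Lmax = foldr ℕ._⊔_ 0 (map lv (allFin n))

  IsMinWPPIDS : Subset n → Set
  IsMinWPPIDS T = IsWPPIDS T × (∀ T' → IsWPPIDS T' → ∣ T ∣ ℕ.≤ ∣ T' ∣)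

_^ℚ_ : ℚ → ℕ → ℚ
q ^ℚ zero  = 1ℚ
q ^ℚ suc k = q * (q ^ℚ k)

-- "k ≤ (1 + ln x) · m" for naturals k, m and rational x.
-- For m > 0 this is  e^r ≤ x  with r = k/m - 1, where e^r is the supremum of
-- the increasing sequence (1 + r/N)^N over N with 1 + r/N > 0.
-- For m = 0 the right-hand side is read as 0.
OnePlusLnBound : ℕ → ℕ → ℚ → Set
OnePlusLnBound k zero x = k ≡ 0
OnePlusLnBound k (suc m) x =
  ∀ j → let N = suc j
            M = N ℕ.* suc m
            num = (+ M) ℤ.+ ((+ k) ℤ.- (+ suc m))  -- 1 + r/N = num / M
        in ℤ.0ℤ ℤ.< num → (num / M) ^ℚ N ≤ x

{-# OPTIONS --safe #-}
module Submission where

-- Write H = Σ_v W(v)/2. Then h(A) = H whenever A is a WPPIDS, and h_A(v) = W(v)/2 ⊓ W_A(v) for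
-- v ∉ A; as t ↦ c ⊓ t is concave and A ↦ W_A(v) is modular, h is monotone and submodular. A
-- vertex v ∉ S with W_S(v) < W(v)/2 has positive gain, so the greedy output is a WPPIDS.
-- Each h_A(v) is an integer multiple of 1/l(v), so every positive gain is at least 1/L and k
-- more greedy steps need a deficit H − h(A) of at least k/L. For a WPPIDS S* with m elements,
-- submodularity bounds the deficit by m times the largest gain; hence the initial deficit is at
-- most m·(3/2)W and each step multiplies the deficit by at most (m − 1)/m. After a = k − m of
-- the k steps, m/L ≤ ((m − 1)/m)^a·m·(3/2)W, i.e. (m/(m − 1))^a ≤ (3/2)LW. Two Bernoulli-type
-- inequalities give (1 + a/(Nm))^N ≤ (m/(m − 1))^a for every N ≥ 1, which is how OnePlusLnBound
-- expresses k ≤ (1 + ln((3/2)LW))·m.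

open import Algebra.Construct.NaturalChoice.Base using (MaxOperator)
import Algebra.Construct.NaturalChoice.MaxOp as MaxOp
open import Data.Bool as Bool using (true; false; if_then_else_)
open import Data.Empty using (⊥-elim)
open import Data.Fin as Fin using (Fin; zero; suc; punchIn)
open import Data.Fin.Properties using (¬∀⟶∃¬; punchInᵢ≢i)
open import Data.Fin.Subset using (Subset; _∈_; _∉_; _⊆_; _∪_; ⁅_⁆; ⊥; ∣_∣; inside; outside)
open import Data.Fin.Subset.Properties using (_∈?_; ∣⊥∣≡0; x∈p∪q⁻; x∈p∪q⁺; x∈⁅x⁆; x∈⁅y⁆⇒x≡y; ∉⊥; p⊆p∪q; q⊆p∪q; ⊆-antisym; ∪-assoc; ∪-identityʳ)
open import Data.List using (List; []; _∷_; foldr; map; filter; allFin; tabulate)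
open import Data.List.Membership.Propositional using () renaming (_∈_ to _∈ₗ_)
open import Data.List.Membership.Propositional.Properties using (∈-map⁺; ∈-map⁻; ∈-filter⁺; ∈-allFin)
import Data.List.Properties as Listₚ
open import Data.List.Relation.Unary.Any using (here; there)
open import Data.Nat as ℕ using (ℕ; zero; suc)
import Data.Nat.Coprimality as Coprime
open import Data.Nat.Divisibility using (_∣_; ∣-refl; ∣-trans; divides)
open import Data.Nat.GCD using (gcd)
open import Data.Nat.LCM using (lcm; m∣lcm[m,n]; n∣lcm[m,n]; gcd*lcm)
import Data.Nat.Properties as ℕₚ
open import Data.Product using (∃-syntax; _×_; _,_; map₂)
open import Data.Sum using (inj₁; inj₂)
open import Data.Vec using ([]; _∷_; here; there)
open import Function using (_∘_)
open import Relation.Binary.Bundles using (TotalPreorder)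
open import Relation.Binary.Construct.Closure.ReflexiveTransitive using (Star; ε; _◅_)
open import Relation.Binary.PropositionalEquality
open import Relation.Nullary using (yes; no; ¬_)
open import Relation.Nullary.Decidable using (isYes; toSum)
open import Relation.Unary using (Pred; Decidable)

-- Bernoulli-type inequalities

-- Placed before the imports of ℤ and ℚ so that ℕ's arithmetic can be opened unqualified here.
module _ where
  open import Data.Nat
  open import Data.Nat.Properties
  open import Data.Nat.Solver using (module +-*-Solver)
  open +-*-Solver
  open ≤-Reasoning

  ^-distribʳ-* : ∀ x y n → (x * y) ^ n ≡ x ^ n * y ^ n
  ^-distribʳ-* x y zero    = refl
  ^-distribʳ-* x y (suc n) = begin-equality
    x * y * (x * y) ^ n     ≡⟨ cong (x * y *_) (^-distribʳ-* x y n) ⟩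
    x * y * (x ^ n * y ^ n) ≡⟨ solve 4 (λ x y p q → x :* y :* (p :* q) := (x :* p) :* (y :* q)) refl x y (x ^ n) (y ^ n) ⟩
    x ^ suc n * y ^ suc n   ∎

  ^-comm : ∀ x m n → (x ^ m) ^ n ≡ (x ^ n) ^ m
  ^-comm x m n = trans (^-*-assoc x m n) (trans (cong (x ^_) (*-comm m n)) (sym (^-*-assoc x n m)))

  [1+1/M]^a≥1+a/M : ∀ M a → M ^ a * (M + a) ≤ M * (M + 1) ^ a
  [1+1/M]^a≥1+a/M M zero    = ≤-reflexive (solve 1 (λ M → con 1 :* (M :+ con 0) := M :* con 1) refl M)
  [1+1/M]^a≥1+a/M M (suc a) = begin
    M ^ suc a * (M + suc a)
      ≡⟨ solve 3 (λ M p a → (M :* p) :* (M :+ (con 1 :+ a)) := M :* (p :* (M :+ a)) :+ M :* p) refl M (M ^ a) a ⟩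
    M * (M ^ a * (M + a)) + M * M ^ a
      ≤⟨ +-monoʳ-≤ (M * (M ^ a * (M + a))) M^[a+1]≤M^a[M+a] ⟩
    M * (M ^ a * (M + a)) + M ^ a * (M + a)
      ≡⟨ solve 2 (λ M q → M :* q :+ q := (M :+ con 1) :* q) refl M (M ^ a * (M + a)) ⟩
    (M + 1) * (M ^ a * (M + a))
      ≤⟨ *-monoʳ-≤ (M + 1) ([1+1/M]^a≥1+a/M M a) ⟩
    (M + 1) * (M * (M + 1) ^ a)
      ≡⟨ solve 3 (λ M r s → r :* (M :* s) := M :* (r :* s)) refl M (M + 1) ((M + 1) ^ a) ⟩
    M * (M + 1) ^ suc a ∎
    where
    M^[a+1]≤M^a[M+a] : M * M ^ a ≤ M ^ a * (M + a)
    M^[a+1]≤M^a[M+a] = subst (_≤ M ^ a * (M + a)) (*-comm (M ^ a) M) (*-monoʳ-≤ (M ^ a) (m≤m+n M a))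

  -- M − N is passed as d with N + d ≡ M, so that the induction on N can keep M and raise d.
  [1+1/M]^N≤M/[M-N] : ∀ N d M → N + d ≡ M → (M + 1) ^ N * d ≤ M ^ N * M
  [1+1/M]^N≤M/[M-N] zero    d M refl = ≤-refl
  [1+1/M]^N≤M/[M-N] (suc N) d M eq = *-cancelʳ-≤ _ _ (suc d) (begin
    (M + 1) ^ suc N * d * suc d
      ≡⟨ solve 4 (λ M d p sd → (M :+ con 1) :* p :* d :* sd := ((M :+ con 1) :* d) :* (p :* sd)) refl M d ((M + 1) ^ N) (suc d) ⟩
    ((M + 1) * d) * ((M + 1) ^ N * suc d)
      ≤⟨ *-monoʳ-≤ ((M + 1) * d) ([1+1/M]^N≤M/[M-N] N (suc d) M (trans (+-suc N d) eq)) ⟩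
    ((M + 1) * d) * (M ^ N * M)
      ≤⟨ *-monoˡ-≤ (M ^ N * M) [M+1]d≤M[d+1] ⟩
    (M * suc d) * (M ^ N * M)
      ≡⟨ solve 4 (λ M sd q m → (M :* sd) :* (q :* m) := M :* q :* m :* sd) refl M (suc d) (M ^ N) M ⟩
    M ^ suc N * M * suc d ∎)
    where
    [M+1]d≤M[d+1] : (M + 1) * d ≤ M * suc d
    [M+1]d≤M[d+1] = begin
      (M + 1) * d ≡⟨ solve 2 (λ M d → (M :+ con 1) :* d := d :+ M :* d) refl M d ⟩
      d + M * d   ≤⟨ +-monoˡ-≤ (M * d) (subst (d ≤_) eq (m≤n+m d (suc N))) ⟩
      M + M * d   ≡⟨ sym (*-suc M d) ⟩
      M * suc d   ∎

  [1+1/Nm]^N≤m/[m-1] : ∀ j m′ → let N = suc j ; M = N * suc m′ in (M + 1) ^ N * m′ ≤ suc m′ * M ^ N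
  [1+1/Nm]^N≤m/[m-1] j m′ = *-cancelˡ-≤ N (begin
    N * ((M + 1) ^ N * m′) ≡⟨ solve 3 (λ N p m → N :* (p :* m) := p :* (N :* m)) refl N ((M + 1) ^ N) m′ ⟩
    (M + 1) ^ N * (N * m′) ≤⟨ [1+1/M]^N≤M/[M-N] N (N * m′) M (sym (*-suc N m′)) ⟩
    M ^ N * M             ≡⟨ solve 3 (λ N m q → q :* (N :* (con 1 :+ m)) := N :* ((con 1 :+ m) :* q)) refl N m′ (M ^ N) ⟩
    N * (suc m′ * M ^ N)  ∎)
    where
    N M : ℕ
    N = suc j
    M = N * suc m′

  [1+a/Nm]^N≤[m/[m-1]]^a : ∀ j m′ a → let N = suc j ; M = N * suc m′ in (M + a) ^ N * m′ ^ a ≤ M ^ N * suc m′ ^ a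
  [1+a/Nm]^N≤[m/[m-1]]^a j m′ a = *-cancelʳ-≤ _ _ X {{m^n≢0 (M ^ N) a {{m^n≢0 M N}}}} (begin
    (M + a) ^ N * m′ ^ a * X ≡⟨ solve 3 (λ p q x → p :* q :* x := (x :* p) :* q) refl ((M + a) ^ N) (m′ ^ a) X ⟩
    X * (M + a) ^ N * m′ ^ a ≤⟨ *-monoˡ-≤ (m′ ^ a) XM+a≤M^NY ⟩
    M ^ N * Y * m′ ^ a       ≡⟨ *-assoc (M ^ N) Y (m′ ^ a) ⟩
    M ^ N * (Y * m′ ^ a)     ≤⟨ *-monoʳ-≤ (M ^ N) Ym′^a≤m^aX ⟩
    M ^ N * (suc m′ ^ a * X) ≡⟨ *-assoc (M ^ N) _ X ⟨
    M ^ N * suc m′ ^ a * X   ∎)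
    where
    N M X Y : ℕ
    N = suc j
    M = N * suc m′
    X = (M ^ N) ^ a
    Y = ((M + 1) ^ N) ^ a
    XM+a≤M^NY : X * (M + a) ^ N ≤ M ^ N * Y
    XM+a≤M^NY = begin
      X * (M + a) ^ N           ≡⟨ cong (_* (M + a) ^ N) (^-comm M N a) ⟩
      (M ^ a) ^ N * (M + a) ^ N ≡⟨ ^-distribʳ-* (M ^ a) (M + a) N ⟨
      (M ^ a * (M + a)) ^ N     ≤⟨ ^-monoˡ-≤ N ([1+1/M]^a≥1+a/M M a) ⟩
      (M * (M + 1) ^ a) ^ N     ≡⟨ ^-distribʳ-* M ((M + 1) ^ a) N ⟩
      M ^ N * ((M + 1) ^ a) ^ N ≡⟨ cong (M ^ N *_) (^-comm (M + 1) a N) ⟩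
      M ^ N * Y                 ∎
    Ym′^a≤m^aX : Y * m′ ^ a ≤ suc m′ ^ a * X
    Ym′^a≤m^aX = begin
      Y * m′ ^ a               ≡⟨ ^-distribʳ-* ((M + 1) ^ N) m′ a ⟨
      ((M + 1) ^ N * m′) ^ a   ≤⟨ ^-monoˡ-≤ a ([1+1/Nm]^N≤m/[m-1] j m′) ⟩
      (suc m′ * M ^ N) ^ a     ≡⟨ ^-distribʳ-* (suc m′) (M ^ N) a ⟩
      suc m′ ^ a * X           ∎

open import Data.Integer as ℤ using (ℤ; +_)
import Data.Integer.Properties as ℤₚ
open import Data.Rational as ℚ using (ℚ; mkℚ; 0ℚ; 1ℚ; ½; _+_; _-_; _*_; -_; _≤_; _<_; _⊓_; _/_)
import Data.Rational.Properties as ℚₚ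
open import Data.Rational.Solver using (module +-*-Solver)
import Data.Rational.Unnormalised as ℚᵘ
import Data.Rational.Unnormalised.Properties as ℚᵘₚ
open import Algebra.Properties.CommutativeMonoid.Sum ℚₚ.+-0-commutativeMonoid using (sum; sum-cong-≗; ∑-distrib-+; sum-remove; sum-replicate-zero)
open import Defs using (WGraph; IsWPPIDS; GreedyStops; GreedyStep; GreedyOutput; IsMinWPPIDS; Lmax; Wmax; lv; _^ℚ_; OnePlusLnBound)
import Defs as D

open +-*-Solver

fromℤ : ℤ → ℚ
fromℤ z = mkℚ z 0 (Coprime.sym (Coprime.1-coprimeTo _))

fromℕ : ℕ → ℚ
fromℕ n = fromℤ (+ n)

fromℤ≡/1 : ∀ z → z / 1 ≡ fromℤ z
fromℤ≡/1 z = ℚₚ.fromℚᵘ-toℚᵘ (fromℤ z)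

fromℤ-+ : ∀ a b → fromℤ (a ℤ.+ b) ≡ fromℤ a + fromℤ b
fromℤ-+ a b = sym (trans (cong₂ (λ x y → (x ℤ.+ y) / 1) (ℤₚ.*-identityʳ a) (ℤₚ.*-identityʳ b)) (fromℤ≡/1 (a ℤ.+ b)))

fromℤ-* : ∀ a b → fromℤ (a ℤ.* b) ≡ fromℤ a * fromℤ b
fromℤ-* a b = sym (fromℤ≡/1 (a ℤ.* b))

fromℤ-neg : ∀ a → fromℤ (ℤ.- a) ≡ - fromℤ a
fromℤ-neg (+ zero)   = refl
fromℤ-neg (+ suc m)  = refl
fromℤ-neg ℤ.-[1+ m ] = refl

fromℤ-mono-≤ : ∀ {a b} → a ℤ.≤ b → fromℤ a ≤ fromℤ b
fromℤ-mono-≤ {a} {b} a≤b = ℚ.*≤* (subst₂ ℤ._≤_ (sym (ℤₚ.*-identityʳ a)) (sym (ℤₚ.*-identityʳ b)) a≤b)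

fromℤ-cancel-≤ : ∀ {a b} → fromℤ a ≤ fromℤ b → a ℤ.≤ b
fromℤ-cancel-≤ {a} {b} (ℚ.*≤* a≤b) = subst₂ ℤ._≤_ (ℤₚ.*-identityʳ a) (ℤₚ.*-identityʳ b) a≤b

fromℤ-cancel-< : ∀ {a b} → fromℤ a < fromℤ b → a ℤ.< b
fromℤ-cancel-< {a} {b} (ℚ.*<* a<b) = subst₂ ℤ._<_ (ℤₚ.*-identityʳ a) (ℤₚ.*-identityʳ b) a<b

fromℕ-+ : ∀ m n → fromℕ (m ℕ.+ n) ≡ fromℕ m + fromℕ n
fromℕ-+ m n = fromℤ-+ (+ m) (+ n)

fromℕ-* : ∀ m n → fromℕ (m ℕ.* n) ≡ fromℕ m * fromℕ n
fromℕ-* m n = trans (cong fromℤ (ℤₚ.pos-* m n)) (fromℤ-* (+ m) (+ n))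

fromℕ-^ : ∀ m n → fromℕ (m ℕ.^ n) ≡ fromℕ m ^ℚ n
fromℕ-^ m zero    = refl
fromℕ-^ m (suc n) = trans (fromℕ-* m (m ℕ.^ n)) (cong (fromℕ m *_) (fromℕ-^ m n))

fromℕ-mono-≤ : ∀ {m n} → m ℕ.≤ n → fromℕ m ≤ fromℕ n
fromℕ-mono-≤ m≤n = fromℤ-mono-≤ (ℤ.+≤+ m≤n)

fromℕ-cancel-≤ : ∀ {m n} → fromℕ m ≤ fromℕ n → m ℕ.≤ n
fromℕ-cancel-≤ m≤n = ℤₚ.drop‿+≤+ (fromℤ-cancel-≤ m≤n)

fromℕ-nonNeg : ∀ n → 0ℚ ≤ fromℕ n
fromℕ-nonNeg n = fromℕ-mono-≤ ℕ.z≤n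

fromℕ-pos : ∀ {n} → 0 ℕ.< n → 0ℚ < fromℕ n
fromℕ-pos {n} 0<n = ℚ.*<* (subst (+ 0 ℤ.<_) (sym (ℤₚ.*-identityʳ (+ n))) (ℤ.+<+ 0<n))

^ℚ-distribʳ-* : ∀ p q n → (p * q) ^ℚ n ≡ p ^ℚ n * q ^ℚ n
^ℚ-distribʳ-* p q zero    = refl
^ℚ-distribʳ-* p q (suc n) = trans (cong (p * q *_) (^ℚ-distribʳ-* p q n))
  (solve 4 (λ p q a b → p :* q :* (a :* b) := (p :* a) :* (q :* b)) refl p q (p ^ℚ n) (q ^ℚ n))

^ℚ-nonNeg : ∀ {p} n → 0ℚ ≤ p → 0ℚ ≤ p ^ℚ n
^ℚ-nonNeg     zero    _   = fromℕ-nonNeg 1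
^ℚ-nonNeg {p} (suc n) 0≤p = ℚₚ.nonNegative⁻¹ _
  {{ℚₚ.nonNeg*nonNeg⇒nonNeg p {{ℚ.nonNegative 0≤p}} (p ^ℚ n) {{ℚ.nonNegative (^ℚ-nonNeg n 0≤p)}}}}

/-*-fromℕ : ∀ z d → (z / suc d) * fromℕ (suc d) ≡ fromℤ z
/-*-fromℕ z d = ℚₚ.toℚᵘ-injective (ℚᵘₚ.≃-trans (ℚₚ.toℚᵘ-homo-* (z / suc d) (fromℕ (suc d)))
  (ℚᵘₚ.≃-trans (ℚᵘₚ.*-congʳ (ℚₚ.toℚᵘ-fromℚᵘ (ℚᵘ.mkℚᵘ z d))) (ℚᵘ.*≡* eq)))
  where
  eq : (z ℤ.* + suc d) ℤ.* + 1 ≡ z ℤ.* + (suc d ℕ.* 1)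
  eq = trans (ℤₚ.*-identityʳ _) (cong (λ t → z ℤ.* + t) (sym (ℕₚ.*-identityʳ (suc d))))

*-fromℕ-denominator : ∀ q c → q * fromℕ (c ℕ.* ℚ.denominatorℕ q) ≡ fromℤ (ℚ.numerator q ℤ.* + c)
*-fromℕ-denominator (mkℚ p d-1 _) c =
  trans (ℚₚ.fromℚᵘ-cong {ℚᵘ.mkℚᵘ (p ℤ.* + (c ℕ.* suc d-1)) (d-1 ℕ.* 1)} {ℚᵘ.mkℚᵘ (p ℤ.* + c) 0} (ℚᵘ.*≡* (begin
    p ℤ.* + (c ℕ.* suc d-1) ℤ.* + 1    ≡⟨ ℤₚ.*-identityʳ _ ⟩
    p ℤ.* + (c ℕ.* suc d-1)            ≡⟨ cong (p ℤ.*_) (ℤₚ.pos-* c (suc d-1)) ⟩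
    p ℤ.* (+ c ℤ.* + suc d-1)          ≡⟨ ℤₚ.*-assoc p (+ c) (+ suc d-1) ⟨
    p ℤ.* + c ℤ.* + suc d-1            ≡⟨ cong (λ t → p ℤ.* + c ℤ.* + suc t) (ℕₚ.*-identityʳ d-1) ⟨
    p ℤ.* + c ℤ.* + suc (d-1 ℕ.* 1)    ∎)))
  (fromℤ≡/1 _)
  where open ≡-Reasoning

OnePlusLnBound-intro : ∀ {m′ x} a → fromℕ (suc m′) ^ℚ a ≤ fromℕ m′ ^ℚ a * x →
  OnePlusLnBound (suc m′ ℕ.+ a) (suc m′) x
OnePlusLnBound-intro {m′} {x} a m^a≤m′^ax j _ = ℚₚ.*-cancelʳ-≤-pos K {{ℚ.positive K-pos}} (begin
  r ^ℚ N * K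
    ≡⟨ solve 3 (λ r p q → r :* (p :* q) := r :* p :* q) refl (r ^ℚ N) (fromℕ (M ℕ.^ N)) (fromℕ (m′ ℕ.^ a)) ⟩
  r ^ℚ N * fromℕ (M ℕ.^ N) * fromℕ (m′ ℕ.^ a)
    ≡⟨ cong (_* fromℕ (m′ ℕ.^ a)) r^NM^N≡[M+a]^N ⟩
  fromℕ ((M ℕ.+ a) ℕ.^ N) * fromℕ (m′ ℕ.^ a)
    ≡⟨ fromℕ-* ((M ℕ.+ a) ℕ.^ N) (m′ ℕ.^ a) ⟨
  fromℕ ((M ℕ.+ a) ℕ.^ N ℕ.* m′ ℕ.^ a)
    ≤⟨ fromℕ-mono-≤ ([1+a/Nm]^N≤[m/[m-1]]^a j m′ a) ⟩
  fromℕ (M ℕ.^ N ℕ.* suc m′ ℕ.^ a)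
    ≡⟨ trans (fromℕ-* (M ℕ.^ N) (suc m′ ℕ.^ a)) (cong (fromℕ (M ℕ.^ N) *_) (fromℕ-^ (suc m′) a)) ⟩
  fromℕ (M ℕ.^ N) * fromℕ (suc m′) ^ℚ a
    ≤⟨ ℚₚ.*-monoˡ-≤-nonNeg (fromℕ (M ℕ.^ N)) m^a≤m′^ax ⟩
  fromℕ (M ℕ.^ N) * (fromℕ m′ ^ℚ a * x)
    ≡⟨ cong (λ t → fromℕ (M ℕ.^ N) * (t * x)) (fromℕ-^ m′ a) ⟨
  fromℕ (M ℕ.^ N) * (fromℕ (m′ ℕ.^ a) * x)
    ≡⟨ solve 3 (λ p q x → p :* (q :* x) := x :* (p :* q)) refl (fromℕ (M ℕ.^ N)) (fromℕ (m′ ℕ.^ a)) x ⟩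
  x * K ∎)
  where
  open ℚₚ.≤-Reasoning
  N M : ℕ
  N = suc j
  M = N ℕ.* suc m′
  num : ℤ
  num = + M ℤ.+ (+ (suc m′ ℕ.+ a) ℤ.- + suc m′)
  r K : ℚ
  r = num / M
  K = fromℕ (M ℕ.^ N) * fromℕ (m′ ℕ.^ a)

  num≡M+a : num ≡ + (M ℕ.+ a)
  num≡M+a = cong (λ t → + M ℤ.+ t) (trans (ℤₚ.[+m]-[+n]≡m⊖n (suc m′ ℕ.+ a) (suc m′))
    (trans (ℤₚ.⊖-≥ (ℕₚ.m≤m+n (suc m′) a)) (cong +_ (ℕₚ.m+n∸m≡n (suc m′) a))))

  r^NM^N≡[M+a]^N : r ^ℚ N * fromℕ (M ℕ.^ N) ≡ fromℕ ((M ℕ.+ a) ℕ.^ N)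
  r^NM^N≡[M+a]^N = begin-equality
    r ^ℚ N * fromℕ (M ℕ.^ N)   ≡⟨ cong (r ^ℚ N *_) (fromℕ-^ M N) ⟩
    r ^ℚ N * fromℕ M ^ℚ N      ≡⟨ ^ℚ-distribʳ-* r (fromℕ M) N ⟨
    (r * fromℕ M) ^ℚ N         ≡⟨ cong (_^ℚ N) (trans (/-*-fromℕ num (m′ ℕ.+ j ℕ.* suc m′)) (cong fromℤ num≡M+a)) ⟩
    fromℕ (M ℕ.+ a) ^ℚ N       ≡⟨ fromℕ-^ (M ℕ.+ a) N ⟨
    fromℕ ((M ℕ.+ a) ℕ.^ N)    ∎

  m′^a>0 : 0 ℕ.< m′ ℕ.^ a
  m′^a>0 with m′ ℕ.^ a in m′^a≡
  ... | suc _ = ℕ.s≤s ℕ.z≤n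
  ... | zero  = ⊥-elim (ℚₚ.<-irrefl refl (begin-strict
    0ℚ                      <⟨ fromℕ-pos (ℕₚ.m^n>0 (suc m′) a) ⟩
    fromℕ (suc m′ ℕ.^ a)    ≡⟨ fromℕ-^ (suc m′) a ⟩
    fromℕ (suc m′) ^ℚ a     ≤⟨ m^a≤m′^ax ⟩
    fromℕ m′ ^ℚ a * x       ≡⟨ cong (_* x) (trans (sym (fromℕ-^ m′ a)) (cong fromℕ m′^a≡)) ⟩
    0ℚ * x                  ≡⟨ ℚₚ.*-zeroˡ x ⟩
    0ℚ                      ∎))

  K-pos : 0ℚ < K
  K-pos = subst (0ℚ <_) (fromℕ-* (M ℕ.^ N) (m′ ℕ.^ a)) (fromℕ-pos (ℕₚ.*-mono-< (ℕₚ.m^n>0 M N) m′^a>0))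

p+q≤r+s⇒p-s≤r-q : ∀ {p q r s} → p + q ≤ r + s → p - s ≤ r - q
p+q≤r+s⇒p-s≤r-q {p} {q} {r} {s} p+q≤r+s = begin
  p - s             ≡⟨ solve 3 (λ p q s → p :- s := p :+ q :- (q :+ s)) refl p q s ⟩
  p + q - (q + s)   ≤⟨ ℚₚ.+-monoˡ-≤ (- (q + s)) p+q≤r+s ⟩
  r + s - (q + s)   ≡⟨ solve 3 (λ q r s → r :+ s :- (q :+ s) := r :- q) refl q r s ⟩
  r - q             ∎
  where open ℚₚ.≤-Reasoning

p-q≤p : ∀ p {q} → 0ℚ ≤ q → p - q ≤ p
p-q≤p p {q} 0≤q = subst (p - q ≤_) (ℚₚ.+-identityʳ p) (ℚₚ.+-monoʳ-≤ p (ℚₚ.neg-antimono-≤ 0≤q))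

p≤p+q : ∀ p {q} → 0ℚ ≤ q → p ≤ p + q
p≤p+q p {q} 0≤q = subst (_≤ p + q) (ℚₚ.+-identityʳ p) (ℚₚ.+-monoʳ-≤ p 0≤q)

≤⇒0≤- : ∀ {p q} → p ≤ q → 0ℚ ≤ q - p
≤⇒0≤- {p} {q} p≤q = subst (_≤ q - p) (ℚₚ.+-inverseʳ p) (ℚₚ.+-monoˡ-≤ (- p) p≤q)

⊓-increments-antitone : ∀ c {y y′ e} → y ≤ y′ → 0ℚ ≤ e → c ⊓ (y′ + e) + c ⊓ y ≤ c ⊓ (y + e) + c ⊓ y′
⊓-increments-antitone c {y} {y′} {e} y≤y′ 0≤e with c ℚₚ.≤? y′ | c ℚₚ.≤? y + e
... | yes c≤y′ | _ = begin
  c ⊓ (y′ + e) + c ⊓ y   ≤⟨ ℚₚ.+-mono-≤ (ℚₚ.p⊓q≤p c _) (ℚₚ.⊓-monoʳ-≤ c (p≤p+q y 0≤e)) ⟩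
  c + c ⊓ (y + e)        ≡⟨ ℚₚ.+-comm c _ ⟩
  c ⊓ (y + e) + c        ≡⟨ cong (λ t → c ⊓ (y + e) + t) (ℚₚ.p≤q⇒p⊓q≡p c≤y′) ⟨
  c ⊓ (y + e) + c ⊓ y′   ∎
  where open ℚₚ.≤-Reasoning
... | no c≰y′ | yes c≤y+e = begin
  c ⊓ (y′ + e) + c ⊓ y   ≤⟨ ℚₚ.+-mono-≤ (ℚₚ.p⊓q≤p c _) (ℚₚ.p⊓q≤q c y) ⟩
  c + y                  ≤⟨ ℚₚ.+-monoʳ-≤ c y≤y′ ⟩
  c + y′                 ≡⟨ cong₂ _+_ (ℚₚ.p≤q⇒p⊓q≡p c≤y+e) (ℚₚ.p≥q⇒p⊓q≡q (ℚₚ.<⇒≤ (ℚₚ.≰⇒> c≰y′))) ⟨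
  c ⊓ (y + e) + c ⊓ y′   ∎
  where open ℚₚ.≤-Reasoning
... | no c≰y′ | no c≰y+e = begin
  c ⊓ (y′ + e) + c ⊓ y   ≤⟨ ℚₚ.+-mono-≤ (ℚₚ.p⊓q≤q c _) (ℚₚ.p⊓q≤q c y) ⟩
  y′ + e + y             ≡⟨ solve 3 (λ y y′ e → y′ :+ e :+ y := y :+ e :+ y′) refl y y′ e ⟩
  y + e + y′             ≡⟨ cong₂ _+_ (ℚₚ.p≥q⇒p⊓q≡q (ℚₚ.<⇒≤ (ℚₚ.≰⇒> c≰y+e))) (ℚₚ.p≥q⇒p⊓q≡q (ℚₚ.<⇒≤ (ℚₚ.≰⇒> c≰y′))) ⟨
  c ⊓ (y + e) + c ⊓ y′   ∎
  where open ℚₚ.≤-Reasoning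

module _ {a ℓ₁ ℓ₂} {O : TotalPreorder a ℓ₁ ℓ₂} (maxOp : MaxOperator O) where
  open TotalPreorder O using (_≲_)
  open MaxOperator maxOp using (_⊔_)
  open MaxOp maxOp using (x≤x⊔y; x≤y⇒x≤z⊔y)

  ∈⇒≤-foldr-⊔ : ∀ e {x xs} → x ∈ₗ xs → x ≲ foldr _⊔_ e xs
  ∈⇒≤-foldr-⊔ e (here refl)  = x≤x⊔y _ _
  ∈⇒≤-foldr-⊔ e (there x∈xs) = x≤y⇒x≤z⊔y _ (∈⇒≤-foldr-⊔ e x∈xs)

∣-foldr-lcm : ∀ b xs → b ∣ foldr lcm b xs
∣-foldr-lcm b []       = ∣-refl
∣-foldr-lcm b (x ∷ xs) = ∣-trans (∣-foldr-lcm b xs) (n∣lcm[m,n] x _)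

∈⇒∣-foldr-lcm : ∀ b {x xs} → x ∈ₗ xs → x ∣ foldr lcm b xs
∈⇒∣-foldr-lcm b {xs = x ∷ xs} (here refl)  = m∣lcm[m,n] x _
∈⇒∣-foldr-lcm b {xs = y ∷ xs} (there x∈xs) = ∣-trans (∈⇒∣-foldr-lcm b x∈xs) (n∣lcm[m,n] y _)

lcm-pos : ∀ {m n} → 0 ℕ.< m → 0 ℕ.< n → 0 ℕ.< lcm m n
lcm-pos {suc m} {suc n} _ _ = ℕₚ.n≢0⇒n>0 λ lcm≡0 → ℕₚ.1+n≢0 (begin
  suc m ℕ.* suc n                         ≡⟨ gcd*lcm (suc m) (suc n) ⟨
  gcd (suc m) (suc n) ℕ.* lcm (suc m) (suc n) ≡⟨ cong (gcd (suc m) (suc n) ℕ.*_) lcm≡0 ⟩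
  gcd (suc m) (suc n) ℕ.* 0               ≡⟨ ℕₚ.*-zeroʳ (gcd (suc m) (suc n)) ⟩
  0                                       ∎)
  where open ≡-Reasoning

denominatorℕ-pos : ∀ q → 0 ℕ.< ℚ.denominatorℕ q
denominatorℕ-pos (mkℚ _ _ _) = ℕ.s≤s ℕ.z≤n

foldr-lcm-pos : ∀ {b} xs → 0 ℕ.< b → (∀ {x} → x ∈ₗ xs → 0 ℕ.< x) → 0 ℕ.< foldr lcm b xs
foldr-lcm-pos []       0<b _      = 0<b
foldr-lcm-pos (x ∷ xs) 0<b 0<xs = lcm-pos (0<xs (here refl)) (foldr-lcm-pos xs 0<b (0<xs ∘ there))

x∈p∪⁅x⁆ : ∀ {n} (p : Subset n) x → x ∈ p ∪ ⁅ x ⁆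
x∈p∪⁅x⁆ p x = x∈p∪q⁺ (inj₂ (x∈⁅x⁆ x))

x∉p∪⁅y⁆ : ∀ {n} {p : Subset n} {x y} → x ∉ p → x ≢ y → x ∉ p ∪ ⁅ y ⁆
x∉p∪⁅y⁆ {p = p} {y = y} x∉p x≢y x∈p∪⁅y⁆ with x∈p∪q⁻ p ⁅ y ⁆ x∈p∪⁅y⁆
... | inj₁ x∈p    = x∉p x∈p
... | inj₂ x∈⁅y⁆ = x≢y (x∈⁅y⁆⇒x≡y y x∈⁅y⁆)

x∈p⇒p∪⁅x⁆≡p : ∀ {n} {p : Subset n} {x} → x ∈ p → p ∪ ⁅ x ⁆ ≡ p
x∈p⇒p∪⁅x⁆≡p {p = p} {x} x∈p = ⊆-antisym p∪⁅x⁆⊆p (p⊆p∪q ⁅ x ⁆)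
  where
  p∪⁅x⁆⊆p : p ∪ ⁅ x ⁆ ⊆ p
  p∪⁅x⁆⊆p y∈p∪⁅x⁆ with x∈p∪q⁻ p ⁅ x ⁆ y∈p∪⁅x⁆
  ... | inj₁ y∈p    = y∈p
  ... | inj₂ y∈⁅x⁆ = subst (_∈ p) (sym (x∈⁅y⁆⇒x≡y x y∈⁅x⁆)) x∈p

∣p∪⁅x⁆∣≡1+∣p∣ : ∀ {n} {p : Subset n} {x} → x ∉ p → ∣ p ∪ ⁅ x ⁆ ∣ ≡ suc ∣ p ∣
∣p∪⁅x⁆∣≡1+∣p∣ {p = inside ∷ p}  {zero}  x∉p = ⊥-elim (x∉p here)
∣p∪⁅x⁆∣≡1+∣p∣ {p = outside ∷ p} {zero}  _   = cong suc (cong ∣_∣ (∪-identityʳ p))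
∣p∪⁅x⁆∣≡1+∣p∣ {p = inside ∷ p}  {suc x} x∉p = cong suc (∣p∪⁅x⁆∣≡1+∣p∣ (x∉p ∘ there))
∣p∪⁅x⁆∣≡1+∣p∣ {p = outside ∷ p} {suc x} x∉p = ∣p∪⁅x⁆∣≡1+∣p∣ (x∉p ∘ there)

∣p∣≡0⇒p≡⊥ : ∀ {n} (p : Subset n) → ∣ p ∣ ≡ 0 → p ≡ ⊥
∣p∣≡0⇒p≡⊥ []            _      = refl
∣p∣≡0⇒p≡⊥ (outside ∷ p) ∣p∣≡0 = cong (outside ∷_) (∣p∣≡0⇒p≡⊥ p ∣p∣≡0)

∣p∣≡1+k⇒p≡q∪⁅x⁆ : ∀ {n k} (p : Subset n) → ∣ p ∣ ≡ suc k → ∃[ q ] ∃[ x ] ∣ q ∣ ≡ k × p ≡ q ∪ ⁅ x ⁆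
∣p∣≡1+k⇒p≡q∪⁅x⁆ (inside ∷ p)  refl = outside ∷ p , zero , refl , cong (inside ∷_) (sym (∪-identityʳ p))
∣p∣≡1+k⇒p≡q∪⁅x⁆ (outside ∷ p) ∣p∣≡1+k with ∣p∣≡1+k⇒p≡q∪⁅x⁆ p ∣p∣≡1+k
... | q , x , ∣q∣≡k , p≡q∪⁅x⁆ = outside ∷ q , suc x , ∣q∣≡k , cong (outside ∷_) p≡q∪⁅x⁆

sum-mono-≤ : ∀ {n} {f g : Fin n → ℚ} → (∀ i → f i ≤ g i) → sum f ≤ sum g
sum-mono-≤ {zero}  f≤g = ℚₚ.≤-refl
sum-mono-≤ {suc n} f≤g = ℚₚ.+-mono-≤ (f≤g zero) (sum-mono-≤ (f≤g ∘ suc))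

sum-nonNeg : ∀ {n} {f : Fin n → ℚ} → (∀ i → 0ℚ ≤ f i) → 0ℚ ≤ sum f
sum-nonNeg {n} {f} 0≤f = subst (_≤ sum f) (sum-replicate-zero n) (sum-mono-≤ 0≤f)

≤-sum : ∀ {n} {f : Fin n → ℚ} → (∀ i → 0ℚ ≤ f i) → ∀ i → f i ≤ sum f
≤-sum {suc n} {f} 0≤f i = begin
  f i                           ≡⟨ ℚₚ.+-identityʳ (f i) ⟨
  f i + 0ℚ                      ≤⟨ ℚₚ.+-monoʳ-≤ (f i) (sum-nonNeg (0≤f ∘ punchIn i)) ⟩
  f i + sum (f ∘ punchIn i)     ≡⟨ sum-remove f ⟨
  sum f                         ∎
  where open ℚₚ.≤-Reasoning

sum-pos⇒∃pos : ∀ {n} (f : Fin n → ℚ) → 0ℚ < sum f → ∃[ i ] 0ℚ < f i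
sum-pos⇒∃pos {n} f 0<Σf = map₂ ℚₚ.≰⇒> (¬∀⟶∃¬ n (λ i → f i ≤ 0ℚ) (λ i → f i ℚₚ.≤? 0ℚ) all≤0⇒⊥)
  where
  all≤0⇒⊥ : ¬ (∀ i → f i ≤ 0ℚ)
  all≤0⇒⊥ f≤0 = ℚₚ.<-irrefl refl (ℚₚ.<-≤-trans 0<Σf (subst (sum f ≤_) (sum-replicate-zero n) (sum-mono-≤ f≤0)))

sum-update : ∀ {n} (f g : Fin n → ℚ) i d → g i ≡ f i + d → (∀ j → j ≢ i → g j ≡ f j) →
  sum g ≡ sum f + d
sum-update {suc n} f g i d gi≡fi+d g≡f = begin
  sum g                               ≡⟨ sum-remove g ⟩
  g i + sum (g ∘ punchIn i)           ≡⟨ cong₂ _+_ gi≡fi+d (sum-cong-≗ (λ j → g≡f (punchIn i j) (punchInᵢ≢i i j))) ⟩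
  f i + d + sum (f ∘ punchIn i)       ≡⟨ solve 3 (λ a d b → a :+ d :+ b := a :+ b :+ d) refl (f i) d _ ⟩
  f i + sum (f ∘ punchIn i) + d       ≡⟨ cong (_+ d) (sum-remove f) ⟨
  sum f + d                           ∎
  where open ≡-Reasoning

sum-─ : ∀ {n} (f g : Fin n → ℚ) → sum (λ i → f i - g i) ≡ sum f - sum g
sum-─ f g = begin
  sum (λ i → f i - g i)
    ≡⟨ solve 2 (λ a b → a := a :+ b :- b) refl (sum (λ i → f i - g i)) (sum g) ⟩
  sum (λ i → f i - g i) + sum g - sum g
    ≡⟨ cong (_- sum g) (∑-distrib-+ (λ i → f i - g i) g) ⟨
  sum (λ i → f i - g i + g i) - sum g
    ≡⟨ cong (_- sum g) (sum-cong-≗ (λ i → solve 2 (λ a b → a :- b :+ b := a) refl (f i) (g i))) ⟩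
  sum f - sum g ∎
  where open ≡-Reasoning

foldr-+-map-allFin : ∀ {n} (f : Fin n → ℚ) → foldr _+_ 0ℚ (map f (allFin n)) ≡ sum f
foldr-+-map-allFin f = trans (cong (foldr _+_ 0ℚ) (Listₚ.map-tabulate (λ i → i) f)) (foldr-tabulate f)
  where
  foldr-tabulate : ∀ {n} (f : Fin n → ℚ) → foldr _+_ 0ℚ (tabulate f) ≡ sum f
  foldr-tabulate {zero}  f = refl
  foldr-tabulate {suc n} f = cong (λ t → f zero + t) (foldr-tabulate (f ∘ suc))

foldr-+-map-filter : ∀ {p} {A : Set} {P : Pred A p} (P? : Decidable P) (g : A → ℚ) xs →
  foldr _+_ 0ℚ (map g (filter P? xs)) ≡ foldr _+_ 0ℚ (map (λ x → if isYes (P? x) then g x else 0ℚ) xs)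
foldr-+-map-filter P? g []       = refl
foldr-+-map-filter P? g (x ∷ xs) with P? x
... | yes _ = cong (λ t → g x + t) (foldr-+-map-filter P? g xs)
... | no  _ = trans (foldr-+-map-filter P? g xs) (sym (ℚₚ.+-identityˡ _))

_↾_ : ∀ {n} → (Fin n → ℚ) → Subset n → Fin n → ℚ
(f ↾ A) u = if isYes (u ∈? A) then f u else 0ℚ

module _ {n} {f : Fin n → ℚ} where

  ↾-∈ : ∀ {A u} → u ∈ A → (f ↾ A) u ≡ f u
  ↾-∈ {A} {u} u∈A with u ∈? A
  ... | yes _   = refl
  ... | no u∉A = ⊥-elim (u∉A u∈A)

  ↾-∉ : ∀ {A u} → u ∉ A → (f ↾ A) u ≡ 0ℚ
  ↾-∉ {A} {u} u∉A with u ∈? A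
  ... | yes u∈A = ⊥-elim (u∉A u∈A)
  ... | no _    = refl

  ↾-mono : (∀ u → 0ℚ ≤ f u) → ∀ {A B} → A ⊆ B → ∀ u → (f ↾ A) u ≤ (f ↾ B) u
  ↾-mono 0≤f {A} {B} A⊆B u with u ∈? A | u ∈? B
  ... | yes _   | yes _   = ℚₚ.≤-refl
  ... | yes u∈A | no u∉B = ⊥-elim (u∉B (A⊆B u∈A))
  ... | no _    | yes _   = 0≤f u
  ... | no _    | no _    = ℚₚ.≤-refl

  ↾-nonNeg : (∀ u → 0ℚ ≤ f u) → ∀ A u → 0ℚ ≤ (f ↾ A) u
  ↾-nonNeg 0≤f A u with u ∈? A
  ... | yes _ = 0≤f u
  ... | no _  = ℚₚ.≤-refl

  sum-↾-⊥ : sum (f ↾ ⊥) ≡ 0ℚ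
  sum-↾-⊥ = trans (sum-cong-≗ {x = f ↾ ⊥} {y = λ _ → 0ℚ} (λ u → ↾-∉ ∉⊥)) (sum-replicate-zero n)

  sum-↾-∪⁅⁆ : ∀ {A u} → u ∉ A → sum (f ↾ (A ∪ ⁅ u ⁆)) ≡ sum (f ↾ A) + f u
  sum-↾-∪⁅⁆ {A} {u} u∉A = sum-update (f ↾ A) (f ↾ (A ∪ ⁅ u ⁆)) u (f u) at-u elsewhere
    where
    at-u : (f ↾ (A ∪ ⁅ u ⁆)) u ≡ (f ↾ A) u + f u
    at-u = begin
      (f ↾ (A ∪ ⁅ u ⁆)) u ≡⟨ ↾-∈ (x∈p∪⁅x⁆ A u) ⟩
      f u                  ≡⟨ ℚₚ.+-identityˡ (f u) ⟨
      0ℚ + f u             ≡⟨ cong (_+ f u) (↾-∉ u∉A) ⟨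
      (f ↾ A) u + f u      ∎
      where open ≡-Reasoning
    elsewhere : ∀ v → v ≢ u → (f ↾ (A ∪ ⁅ u ⁆)) v ≡ (f ↾ A) v
    elsewhere v v≢u with v ∈? A
    ... | yes v∈A = ↾-∈ (x∈p∪q⁺ (inj₁ v∈A))
    ... | no v∉A  = ↾-∉ (x∉p∪⁅y⁆ v∉A v≢u)

-- Integrality

record ScalesToℤ (l : ℕ) (q : ℚ) : Set where
  constructor scalesToℤ
  field
    z     : ℤ
    q*l≡z : q * fromℕ l ≡ fromℤ z

module _ {l : ℕ} where

  scalesToℤ-0 : ScalesToℤ l 0ℚ
  scalesToℤ-0 = scalesToℤ (+ 0) (ℚₚ.*-zeroˡ (fromℕ l))

  scalesToℤ-+ : ∀ {p q} → ScalesToℤ l p → ScalesToℤ l q → ScalesToℤ l (p + q)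
  scalesToℤ-+ {p} {q} (scalesToℤ a pl≡a) (scalesToℤ b ql≡b) = scalesToℤ (a ℤ.+ b) (begin
    (p + q) * fromℕ l          ≡⟨ ℚₚ.*-distribʳ-+ (fromℕ l) p q ⟩
    p * fromℕ l + q * fromℕ l  ≡⟨ cong₂ _+_ pl≡a ql≡b ⟩
    fromℤ a + fromℤ b          ≡⟨ fromℤ-+ a b ⟨
    fromℤ (a ℤ.+ b)            ∎)
    where open ≡-Reasoning

  scalesToℤ-─ : ∀ {p q} → ScalesToℤ l p → ScalesToℤ l q → ScalesToℤ l (p - q)
  scalesToℤ-─ {p} {q} sp (scalesToℤ b ql≡b) = scalesToℤ-+ sp (scalesToℤ (ℤ.- b) (begin
    - q * fromℕ l    ≡⟨ ℚₚ.neg-distribˡ-* q (fromℕ l) ⟨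
    - (q * fromℕ l)  ≡⟨ cong -_ ql≡b ⟩
    - fromℤ b        ≡⟨ fromℤ-neg b ⟨
    fromℤ (ℤ.- b)    ∎))
    where open ≡-Reasoning

  scalesToℤ-sum : ∀ {n} (f : Fin n → ℚ) → (∀ i → ScalesToℤ l (f i)) → ScalesToℤ l (sum f)
  scalesToℤ-sum {zero}  f _  = scalesToℤ-0
  scalesToℤ-sum {suc n} f sf = scalesToℤ-+ (sf zero) (scalesToℤ-sum (f ∘ suc) (sf ∘ suc))

  scalesToℤ-⊓ : ∀ {p q} → ScalesToℤ l p → ScalesToℤ l q → ScalesToℤ l (p ⊓ q)
  scalesToℤ-⊓ {p} {q} sp sq with ℚₚ.⊓-sel p q
  ... | inj₁ p⊓q≡p = subst (ScalesToℤ l) (sym p⊓q≡p) sp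
  ... | inj₂ p⊓q≡q = subst (ScalesToℤ l) (sym p⊓q≡q) sq

  scalesToℤ-↾ : ∀ {n} {f : Fin n → ℚ} → (∀ u → ScalesToℤ l (f u)) → ∀ A u → ScalesToℤ l ((f ↾ A) u)
  scalesToℤ-↾ sf A u with u ∈? A
  ... | yes _ = sf u
  ... | no _  = scalesToℤ-0

  denominator∣⇒scalesToℤ : ∀ q → ℚ.denominatorℕ q ∣ l → ScalesToℤ l q
  denominator∣⇒scalesToℤ q (divides c l≡cd) =
    scalesToℤ (ℚ.numerator q ℤ.* + c) (trans (cong (λ k → q * fromℕ k) l≡cd) (*-fromℕ-denominator q c))

  scalesToℤ-pos⇒1≤ : ∀ {q} → 0 ℕ.< l → ScalesToℤ l q → 0ℚ < q → 1ℚ ≤ q * fromℕ l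
  scalesToℤ-pos⇒1≤ {q} 0<l (scalesToℤ z ql≡z) 0<q =
    subst (1ℚ ≤_) (sym ql≡z) (1≤fromℤ (fromℤ-cancel-< (subst (0ℚ <_) ql≡z 0<ql)))
    where
    0<ql : 0ℚ < q * fromℕ l
    0<ql = ℚₚ.positive⁻¹ _ {{ℚₚ.pos*pos⇒pos q {{ℚ.positive 0<q}} (fromℕ l) {{ℚ.positive (fromℕ-pos 0<l)}}}}
    1≤fromℤ : ∀ {k} → + 0 ℤ.< k → 1ℚ ≤ fromℤ k
    1≤fromℤ (ℤ.+<+ 0<k) = fromℕ-mono-≤ 0<k

-- The potential h

module Potential {n : ℕ} (G : WGraph n) where
  open WGraph G
  open ℚₚ.≤-Reasoning

  W[_]_ : Subset n → Fin n → ℚ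
  W[_]_ = D.W[_]_ G

  Wv : Fin n → ℚ
  Wv = D.Wv G

  ½W : Fin n → ℚ
  ½W v = ½ * Wv v

  hv : Subset n → Fin n → ℚ
  hv = D.hv G

  h : Subset n → ℚ
  h = D.h G

  gain : Subset n → Fin n → ℚ
  gain = D.gain G

  w⁰ : Fin n → Fin n → ℚ
  w⁰ v u = if adj v u then w v u else 0ℚ

  w⁰-nonNeg : ∀ v u → 0ℚ ≤ w⁰ v u
  w⁰-nonNeg v u with adj v u in e
  ... | true  = ℚₚ.<⇒≤ (w-pos v u e)
  ... | false = ℚₚ.≤-refl

  w⁰-sym : ∀ u v → w⁰ u v ≡ w⁰ v u
  w⁰-sym u v with adj u v in e
  ... | true  rewrite trans (sym (adj-sym u v)) e = w-sym u v e
  ... | false rewrite trans (sym (adj-sym u v)) e = refl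

  foldr-+-map-nbrs : ∀ (g : Fin n → ℚ) v →
    foldr _+_ 0ℚ (map g (D.nbrs G v)) ≡ sum (λ u → if adj v u then g u else 0ℚ)
  foldr-+-map-nbrs g v = trans (foldr-+-map-filter (λ u → adj v u Bool.≟ true) g (allFin n))
    (trans (foldr-+-map-allFin (λ u → if isYes (adj v u Bool.≟ true) then g u else 0ℚ)) (sum-cong-≗ if-adj))
    where
    if-adj : ∀ u → (if isYes (adj v u Bool.≟ true) then g u else 0ℚ) ≡ (if adj v u then g u else 0ℚ)
    if-adj u with adj v u
    ... | true  = refl
    ... | false = refl

  Wv-sum : ∀ v → Wv v ≡ sum (w⁰ v)
  Wv-sum v = foldr-+-map-nbrs (w v) v

  W-sum : ∀ A v → W[ A ] v ≡ sum (w⁰ v ↾ A)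
  W-sum A v = trans (foldr-+-map-nbrs _ v) (sum-cong-≗ if-comm)
    where
    if-comm : ∀ u → (if adj v u then (w v ↾ A) u else 0ℚ) ≡ (w⁰ v ↾ A) u
    if-comm u with adj v u | u ∈? A
    ... | true  | _     = refl
    ... | false | yes _ = refl
    ... | false | no _  = refl

  W-nonNeg : ∀ A v → 0ℚ ≤ W[ A ] v
  W-nonNeg A v = subst (0ℚ ≤_) (sym (W-sum A v)) (sum-nonNeg (↾-nonNeg (w⁰-nonNeg v) A))

  W-mono : ∀ {A B} v → A ⊆ B → W[ A ] v ≤ W[ B ] v
  W-mono {A} {B} v A⊆B = subst₂ _≤_ (sym (W-sum A v)) (sym (W-sum B v)) (sum-mono-≤ (↾-mono (w⁰-nonNeg v) A⊆B))

  W-∪⁅⁆ : ∀ {A u} v → u ∉ A → W[ A ∪ ⁅ u ⁆ ] v ≡ W[ A ] v + w⁰ v u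
  W-∪⁅⁆ {A} {u} v u∉A = trans (W-sum (A ∪ ⁅ u ⁆) v) (trans (sum-↾-∪⁅⁆ {f = w⁰ v} u∉A) (cong (_+ w⁰ v u) (sym (W-sum A v))))

  W-⊥ : ∀ v → W[ ⊥ ] v ≡ 0ℚ
  W-⊥ v = trans (W-sum ⊥ v) (sum-↾-⊥ {f = w⁰ v})

  ½W-nonNeg : ∀ v → 0ℚ ≤ ½W v
  ½W-nonNeg v = ℚₚ.*-monoˡ-≤-nonNeg ½ (subst (0ℚ ≤_) (sym (Wv-sum v)) (sum-nonNeg (w⁰-nonNeg v)))

  hv-∈ : ∀ {A v} → v ∈ A → hv A v ≡ ½W v
  hv-∈ {A} {v} v∈A with v ∈? A | ½W v ℚₚ.≤? W[ A ] v
  ... | yes _   | _ = refl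
  ... | no v∉A | _ = ⊥-elim (v∉A v∈A)

  hv-∉ : ∀ {A v} → v ∉ A → hv A v ≡ ½W v ⊓ W[ A ] v
  hv-∉ {A} {v} v∉A with v ∈? A | ½W v ℚₚ.≤? W[ A ] v
  ... | yes v∈A | _        = ⊥-elim (v∉A v∈A)
  ... | no _    | yes ½W≤W = sym (ℚₚ.p≤q⇒p⊓q≡p ½W≤W)
  ... | no _    | no ½W≰W  = sym (ℚₚ.p≥q⇒p⊓q≡q (ℚₚ.<⇒≤ (ℚₚ.≰⇒> ½W≰W)))

  -- Case splits on toSum (v ∈? A) rather than on v ∈? A: a `with` on the latter would also
  -- abstract the test inside hv and block hv-∈ and hv-∉.
  hv-≤-½W : ∀ A v → hv A v ≤ ½W v
  hv-≤-½W A v with toSum (v ∈? A)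
  ... | inj₁ v∈A = ℚₚ.≤-reflexive (hv-∈ v∈A)
  ... | inj₂ v∉A = subst (_≤ ½W v) (sym (hv-∉ v∉A)) (ℚₚ.p⊓q≤p (½W v) _)

  hv-nonNeg : ∀ A v → 0ℚ ≤ hv A v
  hv-nonNeg A v with toSum (v ∈? A)
  ... | inj₁ v∈A = subst (0ℚ ≤_) (sym (hv-∈ v∈A)) (½W-nonNeg v)
  ... | inj₂ v∉A = subst (0ℚ ≤_) (sym (hv-∉ v∉A)) (ℚₚ.⊓-glb (½W-nonNeg v) (W-nonNeg A v))

  hv-mono : ∀ {A B} v → A ⊆ B → hv A v ≤ hv B v
  hv-mono {A} {B} v A⊆B with toSum (v ∈? B) | toSum (v ∈? A)
  ... | inj₁ v∈B | _       = subst (hv A v ≤_) (sym (hv-∈ v∈B)) (hv-≤-½W A v)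
  ... | inj₂ v∉B | inj₁ v∈A = ⊥-elim (v∉B (A⊆B v∈A))
  ... | inj₂ v∉B | inj₂ v∉A = subst₂ _≤_ (sym (hv-∉ v∉A)) (sym (hv-∉ v∉B)) (ℚₚ.⊓-monoʳ-≤ (½W v) (W-mono v A⊆B))

  -- Off A ∪ ⁅ u ⁆ and B ∪ ⁅ u ⁆, hv is ½W v ⊓ W[ _ ] v, and u adds the same w⁰ v u to W[ A ] v and
  -- W[ B ] v, so the concavity of ½W v ⊓ _ applies.
  hv-submodular : ∀ {A B u} v → A ⊆ B → u ∉ B → hv (B ∪ ⁅ u ⁆) v + hv A v ≤ hv (A ∪ ⁅ u ⁆) v + hv B v
  hv-submodular {A} {B} {u} v A⊆B u∉B with toSum (v ∈? A) | toSum (v ∈? B) | v Fin.≟ u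
  ... | inj₁ v∈A | _        | _ = ℚₚ.≤-reflexive (begin-equality
    hv (B ∪ ⁅ u ⁆) v + hv A v ≡⟨ cong₂ _+_ (hv-∈ (p⊆p∪q ⁅ u ⁆ (A⊆B v∈A))) (hv-∈ v∈A) ⟩
    ½W v + ½W v               ≡⟨ cong₂ _+_ (hv-∈ (p⊆p∪q ⁅ u ⁆ v∈A)) (hv-∈ (A⊆B v∈A)) ⟨
    hv (A ∪ ⁅ u ⁆) v + hv B v ∎)
  ... | inj₂ _   | inj₁ v∈B | _ = begin
    hv (B ∪ ⁅ u ⁆) v + hv A v ≡⟨ cong (_+ hv A v) (hv-∈ (p⊆p∪q ⁅ u ⁆ v∈B)) ⟩
    ½W v + hv A v             ≤⟨ ℚₚ.+-monoʳ-≤ (½W v) (hv-mono v (p⊆p∪q ⁅ u ⁆)) ⟩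
    ½W v + hv (A ∪ ⁅ u ⁆) v   ≡⟨ ℚₚ.+-comm (½W v) _ ⟩
    hv (A ∪ ⁅ u ⁆) v + ½W v   ≡⟨ cong (λ t → hv (A ∪ ⁅ u ⁆) v + t) (hv-∈ v∈B) ⟨
    hv (A ∪ ⁅ u ⁆) v + hv B v ∎
  ... | inj₂ _   | inj₂ _   | yes refl = begin
    hv (B ∪ ⁅ u ⁆) v + hv A v ≡⟨ cong (_+ hv A v) (hv-∈ (x∈p∪⁅x⁆ B v)) ⟩
    ½W v + hv A v             ≤⟨ ℚₚ.+-monoʳ-≤ (½W v) (hv-mono v A⊆B) ⟩
    ½W v + hv B v             ≡⟨ cong (_+ hv B v) (hv-∈ (x∈p∪⁅x⁆ A v)) ⟨
    hv (A ∪ ⁅ u ⁆) v + hv B v ∎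
  ... | inj₂ v∉A | inj₂ v∉B | no v≢u = begin
    hv (B ∪ ⁅ u ⁆) v + hv A v                       ≡⟨ cong₂ _+_ (hv-∉ (x∉p∪⁅y⁆ v∉B v≢u)) (hv-∉ v∉A) ⟩
    ½W v ⊓ W[ B ∪ ⁅ u ⁆ ] v + ½W v ⊓ W[ A ] v       ≡⟨ cong (λ t → ½W v ⊓ t + ½W v ⊓ W[ A ] v) (W-∪⁅⁆ v u∉B) ⟩
    ½W v ⊓ (W[ B ] v + w⁰ v u) + ½W v ⊓ W[ A ] v    ≤⟨ ⊓-increments-antitone (½W v) (W-mono v A⊆B) (w⁰-nonNeg v u) ⟩
    ½W v ⊓ (W[ A ] v + w⁰ v u) + ½W v ⊓ W[ B ] v    ≡⟨ cong (λ t → ½W v ⊓ t + ½W v ⊓ W[ B ] v) (W-∪⁅⁆ v (u∉B ∘ A⊆B)) ⟨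
    ½W v ⊓ W[ A ∪ ⁅ u ⁆ ] v + ½W v ⊓ W[ B ] v       ≡⟨ cong₂ _+_ (hv-∉ (x∉p∪⁅y⁆ v∉A v≢u)) (hv-∉ v∉B) ⟨
    hv (A ∪ ⁅ u ⁆) v + hv B v                       ∎

  h-sum : ∀ A → h A ≡ sum (hv A)
  h-sum A = foldr-+-map-allFin (hv A)

  h-mono : ∀ {A B} → A ⊆ B → h A ≤ h B
  h-mono {A} {B} A⊆B = subst₂ _≤_ (sym (h-sum A)) (sym (h-sum B)) (sum-mono-≤ (λ v → hv-mono v A⊆B))

  h-nonNeg : ∀ A → 0ℚ ≤ h A
  h-nonNeg A = subst (0ℚ ≤_) (sym (h-sum A)) (sum-nonNeg (hv-nonNeg A))

  gain-sum : ∀ A u → gain A u ≡ sum (λ v → hv (A ∪ ⁅ u ⁆) v - hv A v)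
  gain-sum A u = trans (cong₂ _-_ (h-sum (A ∪ ⁅ u ⁆)) (h-sum A)) (sym (sum-─ (hv (A ∪ ⁅ u ⁆)) (hv A)))

  gain-nonNeg : ∀ A u → 0ℚ ≤ gain A u
  gain-nonNeg A u = ≤⇒0≤- (h-mono (p⊆p∪q ⁅ u ⁆))

  gain-∈ : ∀ {A u} → u ∈ A → gain A u ≡ 0ℚ
  gain-∈ {A} u∈A = trans (cong (λ B → h B - h A) (x∈p⇒p∪⁅x⁆≡p u∈A)) (ℚₚ.+-inverseʳ (h A))

  gain-submodular : ∀ {A B u} → A ⊆ B → u ∉ B → gain B u ≤ gain A u
  gain-submodular {A} {B} {u} A⊆B u∉B = p+q≤r+s⇒p-s≤r-q {h (B ∪ ⁅ u ⁆)} {h A} {h (A ∪ ⁅ u ⁆)} {h B} (begin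
    h (B ∪ ⁅ u ⁆) + h A                      ≡⟨ cong₂ _+_ (h-sum (B ∪ ⁅ u ⁆)) (h-sum A) ⟩
    sum (hv (B ∪ ⁅ u ⁆)) + sum (hv A)        ≡⟨ ∑-distrib-+ (hv (B ∪ ⁅ u ⁆)) (hv A) ⟨
    sum (λ v → hv (B ∪ ⁅ u ⁆) v + hv A v)    ≤⟨ sum-mono-≤ (λ v → hv-submodular v A⊆B u∉B) ⟩
    sum (λ v → hv (A ∪ ⁅ u ⁆) v + hv B v)    ≡⟨ ∑-distrib-+ (hv (A ∪ ⁅ u ⁆)) (hv B) ⟩
    sum (hv (A ∪ ⁅ u ⁆)) + sum (hv B)        ≡⟨ cong₂ _+_ (h-sum (A ∪ ⁅ u ⁆)) (h-sum B) ⟨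
    h (A ∪ ⁅ u ⁆) + h B                      ∎)

  H : ℚ
  H = sum ½W

  h-wppids : ∀ {A} → IsWPPIDS G A → h A ≡ H
  h-wppids {A} wppids = trans (h-sum A) (sum-cong-≗ hv≡½W)
    where
    hv≡½W : ∀ v → hv A v ≡ ½W v
    hv≡½W v with toSum (v ∈? A)
    ... | inj₁ v∈A = hv-∈ v∈A
    ... | inj₂ v∉A = trans (hv-∉ v∉A) (ℚₚ.p≤q⇒p⊓q≡p (wppids v v∉A))

  hv-increment-≤-gain : ∀ A u v → hv (A ∪ ⁅ u ⁆) v - hv A v ≤ gain A u
  hv-increment-≤-gain A u v =
    subst (hv (A ∪ ⁅ u ⁆) v - hv A v ≤_) (sym (gain-sum A u)) (≤-sum (λ v → ≤⇒0≤- (hv-mono v (p⊆p∪q ⁅ u ⁆))) v)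

  -- An uninfluenced v ∉ S would raise hv S v = W[ S ] v to ½W v by joining S.
  stops⇒wppids : ∀ {S} → GreedyStops G S → IsWPPIDS G S
  stops⇒wppids {S} stops v v∉S with ½W v ℚₚ.≤? W[ S ] v
  ... | yes ½W≤W = ½W≤W
  ... | no ½W≰W  = ⊥-elim (ℚₚ.<-irrefl refl (ℚₚ.<-≤-trans 0<gain (stops v v∉S)))
    where
    W<½W : W[ S ] v < ½W v
    W<½W = ℚₚ.≰⇒> ½W≰W
    0<gain : 0ℚ < gain S v
    0<gain = begin-strict
      0ℚ                              ≡⟨ ℚₚ.+-inverseʳ (W[ S ] v) ⟨
      W[ S ] v - W[ S ] v             <⟨ ℚₚ.+-monoˡ-< (- W[ S ] v) W<½W ⟩
      ½W v - W[ S ] v                 ≡⟨ cong₂ _-_ (hv-∈ (x∈p∪⁅x⁆ S v)) (trans (hv-∉ v∉S) (ℚₚ.p≥q⇒p⊓q≡q (ℚₚ.<⇒≤ W<½W))) ⟨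
      hv (S ∪ ⁅ v ⁆) v - hv S v       ≤⟨ hv-increment-≤-gain S v v ⟩
      gain S v                        ∎

  wppids-⊇ : ∀ {T B} → T ⊆ B → IsWPPIDS G T → IsWPPIDS G B
  wppids-⊇ T⊆B wppids v v∉B = ℚₚ.≤-trans (wppids v (v∉B ∘ T⊆B)) (W-mono v T⊆B)

  gain-∪-≤ : ∀ {A θ} → 0ℚ ≤ θ → (∀ u → u ∉ A → gain A u ≤ θ) → ∀ B x → gain (A ∪ B) x ≤ θ
  gain-∪-≤ {A} 0≤θ gain≤θ B x with toSum (x ∈? A ∪ B)
  ... | inj₁ x∈A∪B = subst (_≤ _) (sym (gain-∈ x∈A∪B)) 0≤θ
  ... | inj₂ x∉A∪B = ℚₚ.≤-trans (gain-submodular (p⊆p∪q B) x∉A∪B) (gain≤θ x (x∉A∪B ∘ p⊆p∪q B))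

  h-∪-≤ : ∀ {A θ} → 0ℚ ≤ θ → (∀ u → u ∉ A → gain A u ≤ θ) → ∀ k T → ∣ T ∣ ≡ k → h (A ∪ T) - h A ≤ fromℕ k * θ
  h-∪-≤ {A} {θ} 0≤θ gain≤θ zero T ∣T∣≡0 = ℚₚ.≤-reflexive (begin-equality
    h (A ∪ T) - h A   ≡⟨ cong (λ B → h (A ∪ B) - h A) (∣p∣≡0⇒p≡⊥ T ∣T∣≡0) ⟩
    h (A ∪ ⊥) - h A   ≡⟨ cong (λ B → h B - h A) (∪-identityʳ A) ⟩
    h A - h A         ≡⟨ ℚₚ.+-inverseʳ (h A) ⟩
    0ℚ                ≡⟨ ℚₚ.*-zeroˡ θ ⟨
    fromℕ 0 * θ       ∎)
  h-∪-≤ {A} {θ} 0≤θ gain≤θ (suc k) T ∣T∣≡1+k with ∣p∣≡1+k⇒p≡q∪⁅x⁆ T ∣T∣≡1+k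
  ... | T′ , x , ∣T′∣≡k , refl = begin
    h (A ∪ (T′ ∪ ⁅ x ⁆)) - h A
      ≡⟨ cong (λ B → h B - h A) (∪-assoc A T′ ⁅ x ⁆) ⟨
    h ((A ∪ T′) ∪ ⁅ x ⁆) - h A
      ≡⟨ solve 3 (λ a b c → a :- c := a :- b :+ (b :- c)) refl (h ((A ∪ T′) ∪ ⁅ x ⁆)) (h (A ∪ T′)) (h A) ⟩
    gain (A ∪ T′) x + (h (A ∪ T′) - h A)
      ≤⟨ ℚₚ.+-mono-≤ (gain-∪-≤ 0≤θ gain≤θ T′ x) (h-∪-≤ 0≤θ gain≤θ k T′ ∣T′∣≡k) ⟩
    θ + fromℕ k * θ
      ≡⟨ solve 2 (λ θ k → θ :+ k :* θ := (con 1ℚ :+ k) :* θ) refl θ (fromℕ k) ⟩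
    (1ℚ + fromℕ k) * θ
      ≡⟨ cong (_* θ) (fromℕ-+ 1 k) ⟨
    fromℕ (suc k) * θ ∎

  h-≤ : ∀ A → h A ≤ sum (λ v → W[ A ] v) + sum (½W ↾ A)
  h-≤ A = begin
    h A                                      ≡⟨ h-sum A ⟩
    sum (hv A)                               ≤⟨ sum-mono-≤ hv≤W+½W ⟩
    sum (λ v → W[ A ] v + (½W ↾ A) v)        ≡⟨ ∑-distrib-+ (λ v → W[ A ] v) (½W ↾ A) ⟩
    sum (λ v → W[ A ] v) + sum (½W ↾ A)      ∎
    where
    hv≤W+½W : ∀ v → hv A v ≤ W[ A ] v + (½W ↾ A) v
    hv≤W+½W v with toSum (v ∈? A)
    ... | inj₁ v∈A = begin
      hv A v               ≡⟨ hv-∈ v∈A ⟩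
      ½W v                 ≡⟨ ℚₚ.+-identityˡ (½W v) ⟨
      0ℚ + ½W v            ≤⟨ ℚₚ.+-mono-≤ (W-nonNeg A v) (ℚₚ.≤-reflexive (sym (↾-∈ {f = ½W} v∈A))) ⟩
      W[ A ] v + (½W ↾ A) v ∎
    ... | inj₂ v∉A = begin
      hv A v               ≡⟨ hv-∉ v∉A ⟩
      ½W v ⊓ W[ A ] v      ≤⟨ ℚₚ.p⊓q≤q (½W v) _ ⟩
      W[ A ] v             ≡⟨ ℚₚ.+-identityʳ _ ⟨
      W[ A ] v + 0ℚ        ≡⟨ cong (λ t → W[ A ] v + t) (↾-∉ {f = ½W} v∉A) ⟨
      W[ A ] v + (½W ↾ A) v ∎

  gain-⊥-≤ : ∀ u → gain ⊥ u ≤ Wv u + ½W u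
  gain-⊥-≤ u = begin
    gain ⊥ u
      ≤⟨ p-q≤p _ (h-nonNeg ⊥) ⟩
    h (⊥ ∪ ⁅ u ⁆)
      ≤⟨ h-≤ (⊥ ∪ ⁅ u ⁆) ⟩
    sum (λ v → W[ ⊥ ∪ ⁅ u ⁆ ] v) + sum (½W ↾ (⊥ ∪ ⁅ u ⁆))
      ≡⟨ cong₂ _+_ (sum-cong-≗ W[⁅u⁆]≡w⁰u) (sum-↾-∪⁅⁆ {f = ½W} ∉⊥) ⟩
    sum (w⁰ u) + (sum (½W ↾ ⊥) + ½W u)
      ≡⟨ cong₂ _+_ (sym (Wv-sum u)) (cong (_+ ½W u) (sum-↾-⊥ {f = ½W})) ⟩
    Wv u + (0ℚ + ½W u)
      ≡⟨ cong (λ t → Wv u + t) (ℚₚ.+-identityˡ (½W u)) ⟩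
    Wv u + ½W u ∎
    where
    W[⁅u⁆]≡w⁰u : ∀ v → W[ ⊥ ∪ ⁅ u ⁆ ] v ≡ w⁰ u v
    W[⁅u⁆]≡w⁰u v = trans (W-∪⁅⁆ v ∉⊥) (trans (cong (_+ w⁰ v u) (W-⊥ v)) (trans (ℚₚ.+-identityˡ _) (w⁰-sym v u)))

  denominators : Fin n → List ℕ
  denominators v = map (λ u → ℚ.denominatorℕ (w v u)) (D.nbrs G v)

  lv-pos : ∀ v → 0 ℕ.< lv G v
  lv-pos v = foldr-lcm-pos (denominators v) (denominatorℕ-pos (½W v)) 0<den
    where
    0<den : ∀ {d} → d ∈ₗ denominators v → 0 ℕ.< d
    0<den d∈ds with ∈-map⁻ (λ u → ℚ.denominatorℕ (w v u)) d∈ds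
    ... | u , _ , refl = denominatorℕ-pos (w v u)

  lv-≤-Lmax : ∀ v → lv G v ℕ.≤ Lmax G
  lv-≤-Lmax v = ∈⇒≤-foldr-⊔ ℕₚ.⊔-operator 0 (∈-map⁺ (lv G) (∈-allFin v))

  L : ℚ
  L = fromℕ (Lmax G)

  Wv-≤-Wmax : ∀ v → Wv v ≤ Wmax G
  Wv-≤-Wmax v = ∈⇒≤-foldr-⊔ ℚₚ.⊔-operator 0ℚ (∈-map⁺ Wv (∈-allFin v))

  ½W-scalesToℤ : ∀ v → ScalesToℤ (lv G v) (½W v)
  ½W-scalesToℤ v = denominator∣⇒scalesToℤ (½W v) (∣-foldr-lcm (ℚ.denominatorℕ (½W v)) (denominators v))

  w⁰-scalesToℤ : ∀ v u → ScalesToℤ (lv G v) (w⁰ v u)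
  w⁰-scalesToℤ v u with adj v u in e
  ... | true  = denominator∣⇒scalesToℤ (w v u) (∈⇒∣-foldr-lcm (ℚ.denominatorℕ (½W v))
    (∈-map⁺ (λ u → ℚ.denominatorℕ (w v u)) (∈-filter⁺ (λ u → adj v u Bool.≟ true) (∈-allFin u) e)))
  ... | false = scalesToℤ-0

  W-scalesToℤ : ∀ A v → ScalesToℤ (lv G v) (W[ A ] v)
  W-scalesToℤ A v = subst (ScalesToℤ (lv G v)) (sym (W-sum A v)) (scalesToℤ-sum (w⁰ v ↾ A) (scalesToℤ-↾ (w⁰-scalesToℤ v) A))

  hv-scalesToℤ : ∀ A v → ScalesToℤ (lv G v) (hv A v)
  hv-scalesToℤ A v with toSum (v ∈? A)
  ... | inj₁ v∈A = subst (ScalesToℤ (lv G v)) (sym (hv-∈ v∈A)) (½W-scalesToℤ v)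
  ... | inj₂ v∉A = subst (ScalesToℤ (lv G v)) (sym (hv-∉ v∉A)) (scalesToℤ-⊓ (½W-scalesToℤ v) (W-scalesToℤ A v))

  1≤gain*L : ∀ {A u} → 0ℚ < gain A u → 1ℚ ≤ gain A u * L
  1≤gain*L {A} {u} 0<gain = 1≤Δ*L (sum-pos⇒∃pos Δ (subst (0ℚ <_) (gain-sum A u) 0<gain))
    where
    Δ : Fin n → ℚ
    Δ v = hv (A ∪ ⁅ u ⁆) v - hv A v
    1≤Δ*L : ∃[ v ] 0ℚ < Δ v → 1ℚ ≤ gain A u * L
    1≤Δ*L (v , 0<Δv) = begin
      1ℚ
        ≤⟨ scalesToℤ-pos⇒1≤ (lv-pos v) (scalesToℤ-─ (hv-scalesToℤ (A ∪ ⁅ u ⁆) v) (hv-scalesToℤ A v)) 0<Δv ⟩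
      Δ v * fromℕ (lv G v)
        ≤⟨ ℚₚ.*-monoˡ-≤-nonNeg (Δ v) {{ℚ.nonNegative (ℚₚ.<⇒≤ 0<Δv)}} (fromℕ-mono-≤ (lv-≤-Lmax v)) ⟩
      Δ v * L
        ≤⟨ ℚₚ.*-monoʳ-≤-nonNeg (L) (hv-increment-≤-gain A u v) ⟩
      gain A u * L ∎

-- The greedy run

module Greedy {n : ℕ} (G : WGraph n) where
  open Potential G
  open ℚₚ.≤-Reasoning

  Run : Subset n → Subset n → Set
  Run = Star (GreedyStep G)

  steps : ∀ {A B} → Run A B → ℕ
  steps ε       = 0
  steps (_ ◅ r) = suc (steps r)

  ∣∣-steps : ∀ {A B} (r : Run A B) → ∣ B ∣ ≡ ∣ A ∣ ℕ.+ steps r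
  ∣∣-steps ε = sym (ℕₚ.+-identityʳ _)
  ∣∣-steps {A} ((x , x∉A , _ , _ , refl) ◅ r) =
    trans (∣∣-steps r) (trans (cong (ℕ._+ steps r) (∣p∪⁅x⁆∣≡1+∣p∣ x∉A)) (sym (ℕₚ.+-suc ∣ A ∣ (steps r))))

  ∣∣≡steps : ∀ {S} (r : Run ⊥ S) → ∣ S ∣ ≡ steps r
  ∣∣≡steps r = trans (∣∣-steps r) (cong (ℕ._+ steps r) (∣⊥∣≡0 n))

  deficit : Subset n → ℚ
  deficit A = H - h A

  deficit-∪⁅⁆ : ∀ A x → deficit A ≡ deficit (A ∪ ⁅ x ⁆) + gain A x
  deficit-∪⁅⁆ A x = solve 3 (λ H a b → H :- a := H :- b :+ (b :- a)) refl H (h A) (h (A ∪ ⁅ x ⁆))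

  deficit-wppids : ∀ {S} → IsWPPIDS G S → deficit S ≡ 0ℚ
  deficit-wppids {S} wppids = trans (cong (λ t → H - t) (h-wppids wppids)) (ℚₚ.+-inverseʳ H)

  deficit-≤ : ∀ {A T θ} → IsWPPIDS G T → 0ℚ ≤ θ → (∀ u → u ∉ A → gain A u ≤ θ) → deficit A ≤ fromℕ ∣ T ∣ * θ
  deficit-≤ {A} {T} wppidsT 0≤θ gain≤θ =
    subst (λ t → t - h A ≤ _) (h-wppids (wppids-⊇ (q⊆p∪q A T) wppidsT)) (h-∪-≤ 0≤θ gain≤θ ∣ T ∣ T refl)

  steps-≤ : ∀ {A S} → IsWPPIDS G S → (r : Run A S) → fromℕ (steps r) ≤ deficit A * L
  steps-≤ wppids ε = ℚₚ.≤-reflexive (begin-equality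
    0ℚ          ≡⟨ ℚₚ.*-zeroˡ L ⟨
    0ℚ * L      ≡⟨ cong (_* L) (deficit-wppids wppids) ⟨
    deficit _ * L ∎)
  steps-≤ {A} wppids ((x , _ , 0<gain , _ , refl) ◅ r) = begin
    fromℕ (suc (steps r))
      ≡⟨ fromℕ-+ 1 (steps r) ⟩
    1ℚ + fromℕ (steps r)
      ≤⟨ ℚₚ.+-mono-≤ (1≤gain*L 0<gain) (steps-≤ wppids r) ⟩
    gain A x * L + deficit (A ∪ ⁅ x ⁆) * L
      ≡⟨ solve 3 (λ g d l → g :* l :+ d :* l := (d :+ g) :* l) refl (gain A x) (deficit (A ∪ ⁅ x ⁆)) L ⟩
    (deficit (A ∪ ⁅ x ⁆) + gain A x) * L
      ≡⟨ cong (_* L) (deficit-∪⁅⁆ A x) ⟨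
    deficit A * L ∎

  deficit-contracts : ∀ {A T m′ x} → IsWPPIDS G T → ∣ T ∣ ≡ suc m′ → (∀ u → u ∉ A → gain A u ≤ gain A x) →
    deficit (A ∪ ⁅ x ⁆) * fromℕ (suc m′) ≤ deficit A * fromℕ m′
  deficit-contracts {A} {T} {m′} {x} wppidsT ∣T∣≡1+m′ x-max = begin
    deficit (A ∪ ⁅ x ⁆) * fromℕ (suc m′)
      ≡⟨ cong₂ _*_ D′≡D-θ (fromℕ-+ 1 m′) ⟩
    (D - θ) * (1ℚ + m)
      ≡⟨ solve 3 (λ D θ m → (D :- θ) :* (con 1ℚ :+ m) := D :* m :+ (D :- (con 1ℚ :+ m) :* θ)) refl D θ m ⟩
    D * m + (D - (1ℚ + m) * θ)
      ≤⟨ ℚₚ.+-monoʳ-≤ (D * m) (ℚₚ.+-monoˡ-≤ (- ((1ℚ + m) * θ)) D≤[1+m]θ) ⟩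
    D * m + ((1ℚ + m) * θ - (1ℚ + m) * θ)
      ≡⟨ cong (λ t → D * m + t) (ℚₚ.+-inverseʳ ((1ℚ + m) * θ)) ⟩
    D * m + 0ℚ
      ≡⟨ ℚₚ.+-identityʳ (D * m) ⟩
    D * m ∎
    where
    D θ m : ℚ
    D = deficit A
    θ = gain A x
    m = fromℕ m′
    D′≡D-θ : deficit (A ∪ ⁅ x ⁆) ≡ D - θ
    D′≡D-θ = trans (solve 2 (λ d θ → d := d :+ θ :- θ) refl (deficit (A ∪ ⁅ x ⁆)) θ) (cong (_- θ) (sym (deficit-∪⁅⁆ A x)))
    D≤[1+m]θ : D ≤ (1ℚ + m) * θ
    D≤[1+m]θ = subst (λ k → D ≤ k * θ) (trans (cong fromℕ ∣T∣≡1+m′) (fromℕ-+ 1 m′)) (deficit-≤ wppidsT (gain-nonNeg A x) x-max)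

  geometric-decay : ∀ {A S T m′} → IsWPPIDS G S → IsWPPIDS G T → ∣ T ∣ ≡ suc m′ →
    ∀ a (r : Run A S) → a ℕ.+ suc m′ ℕ.≤ steps r →
    fromℕ (suc m′) ^ℚ a * fromℕ (suc m′) ≤ fromℕ m′ ^ℚ a * (deficit A * L)
  geometric-decay {A} {m′ = m′} wppidsS _ _ zero r m≤steps = begin
    1ℚ * fromℕ (suc m′)  ≡⟨ ℚₚ.*-identityˡ _ ⟩
    fromℕ (suc m′)       ≤⟨ fromℕ-mono-≤ m≤steps ⟩
    fromℕ (steps r)      ≤⟨ steps-≤ wppidsS r ⟩
    deficit A * L        ≡⟨ ℚₚ.*-identityˡ _ ⟨
    1ℚ * (deficit A * L) ∎
  geometric-decay {A} {m′ = m′} wppidsS wppidsT ∣T∣≡1+m′ (suc a) ((x , _ , _ , x-max , refl) ◅ r) (ℕ.s≤s a+m≤steps) = begin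
    P * P ^ℚ a * P
      ≡⟨ ℚₚ.*-assoc P (P ^ℚ a) P ⟩
    P * (P ^ℚ a * P)
      ≤⟨ ℚₚ.*-monoˡ-≤-nonNeg P (geometric-decay wppidsS wppidsT ∣T∣≡1+m′ a r a+m≤steps) ⟩
    P * (Q ^ℚ a * (D′ * L))
      ≡⟨ solve 4 (λ p q d l → p :* (q :* (d :* l)) := q :* (d :* p :* l)) refl P (Q ^ℚ a) D′ L ⟩
    Q ^ℚ a * (D′ * P * L)
      ≤⟨ ℚₚ.*-monoˡ-≤-nonNeg (Q ^ℚ a) {{ℚ.nonNegative 0≤Q^a}} (ℚₚ.*-monoʳ-≤-nonNeg L D′P≤DQ) ⟩
    Q ^ℚ a * (deficit A * Q * L)
      ≡⟨ solve 4 (λ q qa d l → qa :* (d :* q :* l) := q :* qa :* (d :* l)) refl Q (Q ^ℚ a) (deficit A) L ⟩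
    Q * Q ^ℚ a * (deficit A * L) ∎
    where
    P Q D′ : ℚ
    P = fromℕ (suc m′)
    Q = fromℕ m′
    D′ = deficit (A ∪ ⁅ x ⁆)
    0≤Q^a : 0ℚ ≤ Q ^ℚ a
    0≤Q^a = ^ℚ-nonNeg a (fromℕ-nonNeg m′)
    D′P≤DQ : D′ * P ≤ deficit A * Q
    D′P≤DQ = deficit-contracts wppidsT ∣T∣≡1+m′ x-max

  3/2·L·W : ℚ
  3/2·L·W = (+ 3 / 2) * ((+ Lmax G / 1) * Wmax G)

  first-gain*L≤3/2·L·W : ∀ x → gain ⊥ x * L ≤ 3/2·L·W
  first-gain*L≤3/2·L·W x = begin
    gain ⊥ x * L                 ≤⟨ ℚₚ.*-monoʳ-≤-nonNeg L (gain-⊥-≤ x) ⟩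
    (Wv x + ½W x) * L            ≡⟨ cong (_* L) (solve 1 (λ w → w :+ con ½ :* w := con (+ 3 / 2) :* w) refl (Wv x)) ⟩
    (+ 3 / 2) * Wv x * L         ≤⟨ ℚₚ.*-monoʳ-≤-nonNeg L (ℚₚ.*-monoˡ-≤-nonNeg (+ 3 / 2) (Wv-≤-Wmax x)) ⟩
    (+ 3 / 2) * Wmax G * L       ≡⟨ solve 3 (λ c w l → c :* w :* l := c :* (l :* w)) refl (+ 3 / 2) (Wmax G) L ⟩
    (+ 3 / 2) * (L * Wmax G)     ≡⟨ cong (λ l → (+ 3 / 2) * (l * Wmax G)) (fromℤ≡/1 (+ Lmax G)) ⟨
    3/2·L·W                      ∎

  m^a≤m′^a·3/2·L·W : ∀ {S T m′} → IsWPPIDS G S → IsWPPIDS G T → ∣ T ∣ ≡ suc m′ →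
    (r : Run ⊥ S) → ∀ a → a ℕ.+ suc m′ ℕ.≤ steps r → fromℕ (suc m′) ^ℚ a ≤ fromℕ m′ ^ℚ a * 3/2·L·W
  m^a≤m′^a·3/2·L·W {m′ = m′} _ _ _ ε a a+m≤0 = ⊥-elim (ℕₚ.m+1+n≢0 a (ℕₚ.n≤0⇒n≡0 a+m≤0))
  m^a≤m′^a·3/2·L·W {T = T} {m′} wppidsS wppidsT ∣T∣≡1+m′ r@((x , _ , _ , x-max , refl) ◅ _) a a+m≤steps =
    ℚₚ.*-cancelʳ-≤-pos P (begin
      P ^ℚ a * P                         ≤⟨ geometric-decay wppidsS wppidsT ∣T∣≡1+m′ a r a+m≤steps ⟩
      Q ^ℚ a * (deficit ⊥ * L)           ≤⟨ ℚₚ.*-monoˡ-≤-nonNeg (Q ^ℚ a) {{ℚ.nonNegative 0≤Q^a}} (ℚₚ.*-monoʳ-≤-nonNeg L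
                                              (deficit-≤ wppidsT (gain-nonNeg ⊥ x) x-max)) ⟩
      Q ^ℚ a * (fromℕ ∣ T ∣ * θ * L)
        ≡⟨ cong (λ k → Q ^ℚ a * (fromℕ k * θ * L)) ∣T∣≡1+m′ ⟩
      Q ^ℚ a * (P * θ * L)
        ≡⟨ solve 4 (λ q p t l → q :* (p :* t :* l) := q :* p :* (t :* l)) refl (Q ^ℚ a) P θ L ⟩
      Q ^ℚ a * P * (θ * L)
        ≤⟨ ℚₚ.*-monoˡ-≤-nonNeg (Q ^ℚ a * P) {{ℚ.nonNegative 0≤Q^aP}} (first-gain*L≤3/2·L·W x) ⟩
      Q ^ℚ a * P * 3/2·L·W
        ≡⟨ solve 3 (λ q p x → q :* p :* x := q :* x :* p) refl (Q ^ℚ a) P 3/2·L·W ⟩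
      Q ^ℚ a * 3/2·L·W * P ∎)
    where
    P Q θ : ℚ
    P = fromℕ (suc m′)
    Q = fromℕ m′
    θ = gain ⊥ x
    0≤Q^a : 0ℚ ≤ Q ^ℚ a
    0≤Q^a = ^ℚ-nonNeg a (fromℕ-nonNeg m′)
    0≤Q^aP : 0ℚ ≤ Q ^ℚ a * P
    0≤Q^aP = ℚₚ.nonNegative⁻¹ _ {{ℚₚ.nonNeg*nonNeg⇒nonNeg (Q ^ℚ a) {{ℚ.nonNegative 0≤Q^a}} P}}

  greedy-bound : ∀ {S T} → IsWPPIDS G S → (r : Run ⊥ S) → IsMinWPPIDS G T → OnePlusLnBound (steps r) ∣ T ∣ 3/2·L·W
  greedy-bound {S} {T} wppidsS r (wppidsT , minimal) with ∣ T ∣ in ∣T∣≡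
  ... | zero   = ℕₚ.n≤0⇒n≡0 (fromℕ-cancel-≤ (begin
    fromℕ (steps r) ≤⟨ steps-≤ wppidsS r ⟩
    deficit ⊥ * L   ≡⟨ cong (_* L) (deficit-wppids (subst (IsWPPIDS G) (∣p∣≡0⇒p≡⊥ T ∣T∣≡) wppidsT)) ⟩
    0ℚ * L          ≡⟨ ℚₚ.*-zeroˡ L ⟩
    0ℚ              ∎))
  ... | suc m′ = subst (λ k → OnePlusLnBound k (suc m′) 3/2·L·W) (ℕₚ.m+[n∸m]≡n m≤k)
    (OnePlusLnBound-intro a (m^a≤m′^a·3/2·L·W wppidsS wppidsT ∣T∣≡ r a a+m≤k))
    where
    m≤k : suc m′ ℕ.≤ steps r
    m≤k = subst (suc m′ ℕ.≤_) (∣∣≡steps r) (minimal S wppidsS)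
    a : ℕ
    a = steps r ℕ.∸ suc m′
    a+m≤k : a ℕ.+ suc m′ ℕ.≤ steps r
    a+m≤k = ℕₚ.≤-reflexive (trans (ℕₚ.+-comm a (suc m′)) (ℕₚ.m+[n∸m]≡n m≤k))

theorem6 : ∀ {n : ℕ} (G : WGraph n) (S : Subset n) → GreedyOutput G S →
    IsWPPIDS G S ×
    (∀ (S* : Subset n) → IsMinWPPIDS G S* →
    OnePlusLnBound ∣ S ∣ ∣ S* ∣ ((+ 3 / 2) * ((+ Lmax G / 1) * Wmax G)))
theorem6 G S (run , stops) = wppids , λ S* minimal →
  subst (λ k → OnePlusLnBound k ∣ S* ∣ 3/2·L·W) (sym (∣∣≡steps run)) (greedy-bound wppids run minimal)
  where
  open Potential G using (stops⇒wppids)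
  open Greedy G
  wppids : IsWPPIDS G S
  wppids = stops⇒wppids stops
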